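{- Let $G$ be a simple cubic graph with a polyhedral embedding $\Pi$ and extended graph $G^e=G^e(\Pi)$. Let $(u\,t_0\,t_1\,v)$, $(u\,t_2\,t_3\,v)$, $(u\,t_4\,t_5\,v)$ be three pairwise internally disjoint $3$-paths in $G$ such that $[uv]$ is a scaffold edge of $G^e$ and $(t_1\,t_0\,u\,t_4)$ is a $\Pi$-facial subwalk. Then $(v\,t_5\,t_4\,u)$ is a $\Pi$-facial subwalk.
   Context: An embedding of a graph in a surface without boundary is polyhedral if every facial walk is a cycle and any two distinct facial cycles intersect in either the empty set, a single vertex, or a single edge. A $\Pi$-facial subwalk is a walk formed by consecutive vertices of some $\Pi$-facial cycle (in either direction). The extended graph $G^e(\Pi)$ has vertex set $V(G)$ and edge set $E(G)$ together with a multiset $\mathcal S$ of scaffold edges: for distinct vertices $t_0,t_3$, the scaffold edge $[t_0t_3]$ appears with multiplicity equal to the number of paths $(t_0t_1t_2t_3)$ of $G$ that are $\Pi$-facial subwalks; $[uv]$ is a scaffold edge if its multiplicity is at least $1$. -}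

module Defs where

open import Data.Nat using (ℕ; zero; suc)
open import Data.Fin using (Fin; zero; suc)
open import Data.Bool using (Bool; true; false; not; if_then_else_; _xor_)
open import Data.Product using (Σ; ∃; ∃-syntax; _×_; _,_; proj₁)
open import Data.Sum using (_⊎_)
open import Data.Unit using (⊤)
open import Data.Empty using (⊥)
open import Data.List using (List; []; _∷_; reverse)
open import Data.List.Relation.Unary.Unique.Propositional using (Unique)
open import Relation.Binary.PropositionalEquality using (_≡_; _≢_)
open import Relation.Nullary using (¬_)

suc3 : Fin 3 → Fin 3
suc3 zero = suc zero
suc3 (suc zero) = suc (suc zero)
suc3 (suc (suc zero)) = zero

pred3 : Fin 3 → Fin 3
pred3 zero = suc (suc zero)
pred3 (suc zero) = zero
pred3 (suc (suc zero)) = suc zero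

-- The three neighbours of v are  nbr v 0, nbr v 1, nbr v 2  (pairwise
-- distinct, none equal to v), and adjacency is symmetric: v is the
-- (back v i)-th neighbour of nbr v i.

record CubicGraph (n : ℕ) : Set where
  field
    nbr      : Fin n → Fin 3 → Fin n
    back     : Fin n → Fin 3 → Fin 3
    nbr-back : ∀ v i → nbr (nbr v i) (back v i) ≡ v
    nbr-inj  : ∀ v i j → nbr v i ≡ nbr v j → i ≡ j
    loopless : ∀ v i → nbr v i ≢ v

module _ {n : ℕ} (G : CubicGraph n) where
  open CubicGraph G

  Adj : Fin n → Fin n → Set
  Adj u v = ∃[ i ] nbr u i ≡ v

  Consecutive : List (Fin n) → Set
  Consecutive [] = ⊤
  Consecutive (x ∷ []) = ⊤
  Consecutive (x ∷ y ∷ xs) = Adj x y × Consecutive (y ∷ xs)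

  IsPath : List (Fin n) → Set
  IsPath xs = Unique xs × Consecutive xs

-- Rotation at v: for a cubic vertex, the local rotation π_v is one of the
-- two cyclic orders of its neighbours: if rot v = true then
-- π_v(nbr v i) = nbr v (i+1), otherwise π_v(nbr v i) = nbr v (i-1).
-- Signature: sig v i = true means the edge v—nbr v i has signature -1.

record EmbeddingScheme {n : ℕ} (G : CubicGraph n) : Set where
  open CubicGraph G
  field
    rot     : Fin n → Bool
    sig     : Fin n → Fin 3 → Bool
    sig-sym : ∀ v i → sig (nbr v i) (back v i) ≡ sig v i

module _ {n : ℕ} {G : CubicGraph n} (Π : EmbeddingScheme G) where
  open CubicGraph G
  open EmbeddingScheme Π

  πf : Fin n → Fin 3 → Fin 3
  πf v i = if rot v then suc3 i else pred3 i

  πb : Fin n → Fin 3 → Fin 3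
  πb v i = if rot v then pred3 i else suc3 i

  -- Face-tracing state (v , i , s): we are at v, having arrived along the
  -- edge from nbr v i, and the current local orientation is s
  -- (false: continue with π_v, true: continue with π_v⁻¹).
  State : Set
  State = Fin n × Fin 3 × Bool

  vtx : State → Fin n
  vtx = proj₁

  nextIndex : State → Fin 3
  nextIndex (v , i , s) = if s then πb v i else πf v i

  step : State → State
  step (v , i , s) =
    let j = nextIndex (v , i , s) in
    (nbr v j , back v j , s xor sig v j)

  iter : ℕ → State → State
  iter zero σ = σ
  iter (suc m) σ = step (iter m σ)

  -- the same position traversed in the opposite direction
  rev : State → State
  rev (v , i , s) = (v , nextIndex (v , i , s) , not s)

  Traces : State → List (Fin n) → Set
  Traces σ [] = ⊤
  Traces σ (x ∷ xs) = vtx σ ≡ x × Traces (step σ) xs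

  FacialSubwalk : List (Fin n) → Set
  FacialSubwalk xs = ∃[ σ ] (Traces σ xs ⊎ Traces σ (reverse xs))

  SameFace : State → State → Set
  SameFace σ τ = (∃[ m ] iter m σ ≡ τ) ⊎ (∃[ m ] iter m σ ≡ rev τ)

  FaceVertex : State → Fin n → Set
  FaceVertex σ x = ∃[ m ] vtx (iter m σ) ≡ x

  FaceEdge : State → Fin n → Fin n → Set
  FaceEdge σ a b = ∃[ m ] ((vtx (iter m σ) ≡ a × vtx (iter (suc m) σ) ≡ b)
                         ⊎ (vtx (iter m σ) ≡ b × vtx (iter (suc m) σ) ≡ a))

  FacialWalkIsCycle : State → Set
  FacialWalkIsCycle σ = ∀ m m' → vtx (iter m σ) ≡ vtx (iter m' σ) → iter m σ ≡ iter m' σ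

  CommonVertex : State → State → Fin n → Set
  CommonVertex σ τ x = FaceVertex σ x × FaceVertex τ x

  NiceIntersection : State → State → Set
  NiceIntersection σ τ =
      (∀ x → ¬ CommonVertex σ τ x)
    ⊎ (∃[ x ] ∀ y → CommonVertex σ τ y → y ≡ x)
    ⊎ (∃[ a ] ∃[ b ] (FaceEdge σ a b × FaceEdge τ a b ×
                      (∀ y → CommonVertex σ τ y → y ≡ a ⊎ y ≡ b)))

  Polyhedral : Set
  Polyhedral = (∀ σ → FacialWalkIsCycle σ)
             × (∀ σ τ → ¬ SameFace σ τ → NiceIntersection σ τ)

  ScaffoldEdge : Fin n → Fin n → Set
  ScaffoldEdge u v = u ≢ v × ∃[ a ] ∃[ b ]
    (IsPath G (u ∷ a ∷ b ∷ v ∷ []) × FacialSubwalk (u ∷ a ∷ b ∷ v ∷ []))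

module Submission where

-- A face-tracing state is a position (vertex, incoming edge,
-- orientation); its "corner" consists of the previous and the next vertex.
-- Two general facts about polyhedral embeddings of cubic graphs carry the
-- whole argument:
--   * faceThroughThirdEdge: if φ and ω sit at the same vertex x and ω enters
--     x along the edge outside φ's corner, then their faces differ (a face
--     passes x only once) and hence share no vertex besides x and the next
--     vertex of ω.
--   * faceFollowsInducedPath (a consequence): a face that traverses the edge
--     a→b and contains d, where a b c d is a path with b, d non-adjacent,
--     traverses exactly a b c d.
-- For the corollary take a face through u and v (from the scaffold edge).
-- If its corner at u contains t₄, the second fact (read in the right
-- direction) gives the facial subwalk u t₄ t₅ v.  Otherwise its corner at v
-- contains t₁ or t₅; t₁ contradicts the facial subwalk t₁ t₀ u t₄ and t₅
-- contradicts the face around the corner t₅ t₄ u, both by the first fact.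

open import Defs
open import Data.Nat using (ℕ)
open import Data.Fin using (Fin)
open import Data.Product using (_×_)
open import Data.List using ([]; _∷_)
open import Relation.Binary.PropositionalEquality using (_≢_)

open import Data.Nat using (suc; _+_; _*_)
open import Data.Nat.Properties using (n<1+n; m≤n⇒∃[o]m+o≡n; +-suc; *-suc; +-comm)
open import Data.Fin using (zero; suc; toℕ; combine; _≟_)
open import Data.Fin.Properties using (pigeonhole; combine-injective)
open import Data.Bool using (Bool; true; false; not; _xor_)
open import Data.Bool.Properties using (not-involutive; not-distribˡ-xor; xor-assoc; xor-same; xor-identityʳ)
open import Data.Product using (∃-syntax; _,_; proj₁; proj₂)
open import Data.Sum using (_⊎_; inj₁; inj₂)
open import Data.Unit using (tt)
open import Data.Empty using (⊥; ⊥-elim)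
open import Data.List.Relation.Unary.All using (_∷_)
open import Data.List.Relation.Unary.AllPairs.Core using (_∷_)
open import Relation.Binary.PropositionalEquality using (_≡_; refl; sym; trans; cong; cong₂; subst; module ≡-Reasoning)
open import Relation.Nullary using (¬_; yes; no)

suc3≢id : ∀ i → suc3 i ≢ i
suc3≢id zero ()
suc3≢id (suc zero) ()
suc3≢id (suc (suc zero)) ()

pred3≢id : ∀ i → pred3 i ≢ i
pred3≢id zero ()
pred3≢id (suc zero) ()
pred3≢id (suc (suc zero)) ()

pred3-suc3 : ∀ i → pred3 (suc3 i) ≡ i
pred3-suc3 zero = refl
pred3-suc3 (suc zero) = refl
pred3-suc3 (suc (suc zero)) = refl

suc3-pred3 : ∀ i → suc3 (pred3 i) ≡ i
suc3-pred3 zero = refl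
suc3-pred3 (suc zero) = refl
suc3-pred3 (suc (suc zero)) = refl

fin3-exhaust : ∀ i j → j ≡ i ⊎ j ≡ suc3 i ⊎ j ≡ pred3 i
fin3-exhaust zero zero = inj₁ refl
fin3-exhaust zero (suc zero) = inj₂ (inj₁ refl)
fin3-exhaust zero (suc (suc zero)) = inj₂ (inj₂ refl)
fin3-exhaust (suc zero) zero = inj₂ (inj₂ refl)
fin3-exhaust (suc zero) (suc zero) = inj₁ refl
fin3-exhaust (suc zero) (suc (suc zero)) = inj₂ (inj₁ refl)
fin3-exhaust (suc (suc zero)) zero = inj₂ (inj₁ refl)
fin3-exhaust (suc (suc zero)) (suc zero) = inj₂ (inj₂ refl)
fin3-exhaust (suc (suc zero)) (suc (suc zero)) = inj₁ refl

otherTwo : ∀ {a b c x : Fin 3} → a ≢ b → a ≢ c → b ≢ c → x ≢ c → x ≡ a ⊎ x ≡ b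
otherTwo {a} {b} {c} {x} a≢b a≢c b≢c x≢c
  with fin3-exhaust c a | fin3-exhaust c b | fin3-exhaust c x
... | inj₁ a≡c | _ | _ = ⊥-elim (a≢c a≡c)
... | _ | inj₁ b≡c | _ = ⊥-elim (b≢c b≡c)
... | _ | _ | inj₁ x≡c = ⊥-elim (x≢c x≡c)
... | inj₂ (inj₁ refl) | inj₂ (inj₁ refl) | _ = ⊥-elim (a≢b refl)
... | inj₂ (inj₂ refl) | inj₂ (inj₂ refl) | _ = ⊥-elim (a≢b refl)
... | inj₂ (inj₁ refl) | _ | inj₂ (inj₁ refl) = inj₁ refl
... | inj₂ (inj₂ refl) | _ | inj₂ (inj₂ refl) = inj₁ refl
... | _ | inj₂ (inj₁ refl) | inj₂ (inj₁ refl) = inj₂ refl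
... | _ | inj₂ (inj₂ refl) | inj₂ (inj₂ refl) = inj₂ refl

threeDistinctInPair : ∀ {A : Set} {a b x y z : A} → x ≢ y → x ≢ z → y ≢ z →
  x ≡ a ⊎ x ≡ b → y ≡ a ⊎ y ≡ b → z ≡ a ⊎ z ≡ b → ⊥
threeDistinctInPair x≢y _ _ (inj₁ p) (inj₁ q) _ = x≢y (trans p (sym q))
threeDistinctInPair x≢y _ _ (inj₂ p) (inj₂ q) _ = x≢y (trans p (sym q))
threeDistinctInPair _ x≢z _ (inj₁ p) (inj₂ _) (inj₁ r) = x≢z (trans p (sym r))
threeDistinctInPair _ _ y≢z (inj₁ _) (inj₂ q) (inj₂ r) = y≢z (trans q (sym r))
threeDistinctInPair _ _ y≢z (inj₂ _) (inj₁ q) (inj₁ r) = y≢z (trans q (sym r))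
threeDistinctInPair _ x≢z _ (inj₂ p) (inj₁ _) (inj₂ r) = x≢z (trans p (sym r))

module CubicFacts {n : ℕ} (G : CubicGraph n) where
  open CubicGraph G

  adj-sym : ∀ {x y} → Adj G x y → Adj G y x
  adj-sym {x} (i , refl) = back x i , nbr-back x i

  back-back : ∀ x j → back (nbr x j) (back x j) ≡ j
  back-back x j = nbr-inj x _ _
    (subst (λ z → nbr z (back (nbr x j) (back x j)) ≡ nbr x j) (nbr-back x j)
           (nbr-back (nbr x j) (back x j)))

  indicesApart : ∀ {x i j} → nbr x i ≢ nbr x j → i ≢ j
  indicesApart ne i≡j = ne (cong (nbr _) i≡j)

  notAdjacent : ∀ {x a b c y} → Adj G x a → Adj G x b → Adj G x c →
    a ≢ b → a ≢ c → b ≢ c → y ≢ a → y ≢ b → y ≢ c → ¬ Adj G x y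
  notAdjacent {x} (_ , refl) (_ , refl) (_ , refl) a≢b a≢c b≢c y≢a y≢b y≢c (_ , refl)
    with otherTwo (indicesApart a≢b) (indicesApart a≢c) (indicesApart b≢c) (indicesApart y≢c)
  ... | inj₁ e = y≢a (cong (nbr x) e)
  ... | inj₂ e = y≢b (cong (nbr x) e)

module FaceTracing {n : ℕ} {G : CubicGraph n} (Π : EmbeddingScheme G) where
  open CubicGraph G
  open EmbeddingScheme Π
  open CubicFacts G

  St : Set
  St = State Π

  idx : St → Fin 3
  idx σ = proj₁ (proj₂ σ)

  prev : St → Fin n
  prev σ = nbr (vtx Π σ) (idx σ)

  next : St → Fin n
  next σ = vtx Π (step Π σ)

  OnCorner : St → Fin n → Set
  OnCorner σ y = y ≡ prev σ ⊎ y ≡ next σ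

  OnFace : St → Fin n → Set
  OnFace = FaceVertex Π

  nextIndex≢idx : ∀ σ → nextIndex Π σ ≢ idx σ
  nextIndex≢idx (x , i , s) with rot x | s
  ... | true  | true  = pred3≢id i
  ... | true  | false = suc3≢id i
  ... | false | true  = suc3≢id i
  ... | false | false = pred3≢id i

  prev≢next : ∀ σ → prev σ ≢ next σ
  prev≢next σ e = nextIndex≢idx σ (sym (nbr-inj (vtx Π σ) _ _ e))

  nextIndex-rev : ∀ σ → nextIndex Π (rev Π σ) ≡ idx σ
  nextIndex-rev (x , i , s) with rot x | s
  ... | true  | true  = suc3-pred3 i
  ... | true  | false = pred3-suc3 i
  ... | false | true  = pred3-suc3 i
  ... | false | false = suc3-pred3 i

  next-rev : ∀ σ → next (rev Π σ) ≡ prev σ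
  next-rev σ = cong (nbr (vtx Π σ)) (nextIndex-rev σ)

  OnCorner-rev : ∀ {τ y} → OnCorner (rev Π τ) y → OnCorner τ y
  OnCorner-rev (inj₁ e) = inj₂ e
  OnCorner-rev {τ} (inj₂ e) = inj₁ (trans e (next-rev τ))

  rev-involutive : ∀ σ → rev Π (rev Π σ) ≡ σ
  rev-involutive σ@(x , i , s) =
    cong₂ (λ j t → (x , j , t)) (nextIndex-rev σ) (not-involutive s)

  orientation : ∀ x i j → j ≢ i → ∃[ s ] nextIndex Π (x , i , s) ≡ j
  orientation x i j j≢i with fin3-exhaust i j | rot x
  ... | inj₁ j≡i | _ = ⊥-elim (j≢i j≡i)
  ... | inj₂ (inj₁ refl) | true  = false , refl
  ... | inj₂ (inj₁ refl) | false = true , refl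
  ... | inj₂ (inj₂ refl) | true  = true , refl
  ... | inj₂ (inj₂ refl) | false = false , refl

  stateThrough : ∀ {x a b} → Adj G x a → Adj G x b → a ≢ b →
    ∃[ ω ] vtx Π ω ≡ x × prev ω ≡ a × next ω ≡ b
  stateThrough {x} (i , refl) (j , refl) a≢b
    with orientation x i j (λ j≡i → a≢b (cong (nbr x) (sym j≡i)))
  ... | s , e = (x , i , s) , refl , refl , cong (nbr x) e

  prev-step : ∀ ρ → prev (step Π ρ) ≡ vtx Π ρ
  prev-step (x , i , s) = nbr-back x (nextIndex Π (x , i , s))

  adjacentNext : ∀ {σ x} → vtx Π σ ≡ x → Adj G x (next σ)
  adjacentNext {σ} refl = nextIndex Π σ , refl

  rev-step : ∀ ρ → step Π (rev Π (step Π ρ)) ≡ rev Π ρ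
  rev-step ρ@(x , i , s) =
    begin
      step Π (rev Π (step Π ρ))
    ≡⟨ cong (λ k → nbr y k , back y k , not t xor sig y k) (nextIndex-rev (step Π ρ)) ⟩
      nbr y (back x j) , back y (back x j) , not t xor sig y (back x j)
    ≡⟨ cong₂ _,_ (nbr-back x j) (cong₂ _,_ (back-back x j) orientation-restored) ⟩
      x , j , not s
    ∎
    where
    open ≡-Reasoning
    j = nextIndex Π ρ
    y = nbr x j
    t = s xor sig x j
    orientation-restored : not t xor sig y (back x j) ≡ not s
    orientation-restored =
      begin
        not (s xor sig x j) xor sig y (back x j)
      ≡⟨ cong₂ _xor_ (not-distribˡ-xor s (sig x j)) (sig-sym x j) ⟩
        (not s xor sig x j) xor sig x j
      ≡⟨ xor-assoc (not s) (sig x j) (sig x j) ⟩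
        not s xor (sig x j xor sig x j)
      ≡⟨ cong (not s xor_) (xor-same (sig x j)) ⟩
        not s xor false
      ≡⟨ xor-identityʳ (not s) ⟩
        not s
      ∎

  -- the predecessor of a state is recovered as rev ∘ step ∘ rev
  step-injective : ∀ {p q} → step Π p ≡ step Π q → p ≡ q
  step-injective {p} {q} e =
    trans (sym (retrace p)) (trans (cong (λ σ → rev Π (step Π (rev Π σ))) e) (retrace q))
    where
    retrace : ∀ ρ → rev Π (step Π (rev Π (step Π ρ))) ≡ ρ
    retrace ρ = trans (cong (rev Π) (rev-step ρ)) (rev-involutive ρ)

  iter-+ : ∀ m k σ → iter Π m (iter Π k σ) ≡ iter Π (m + k) σ
  iter-+ ℕ.zero k σ = refl
  iter-+ (suc m) k σ = cong (step Π) (iter-+ m k σ)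

  iter-suc : ∀ m σ → iter Π (suc m) σ ≡ iter Π m (step Π σ)
  iter-suc ℕ.zero σ = refl
  iter-suc (suc m) σ = cong (step Π) (iter-suc m σ)

  iter-injective : ∀ k {p q} → iter Π k p ≡ iter Π k q → p ≡ q
  iter-injective ℕ.zero e = e
  iter-injective (suc k) e = iter-injective k (step-injective e)

  bit : Bool → Fin 2
  bit false = zero
  bit true = suc zero

  bit-injective : ∀ {s s'} → bit s ≡ bit s' → s ≡ s'
  bit-injective {false} {false} _ = refl
  bit-injective {true} {true} _ = refl
  bit-injective {false} {true} ()
  bit-injective {true} {false} ()

  encode : St → Fin (n * (3 * 2))
  encode (x , i , s) = combine x (combine i (bit s))

  encode-injective : ∀ p q → encode p ≡ encode q → p ≡ q
  encode-injective (x , i , s) (x' , i' , s') e with combine-injective x _ x' _ e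
  ... | refl , e' with combine-injective i _ i' _ e'
  ... | refl , e'' = cong (λ b → x , i , b) (bit-injective e'')

  -- Since step is injective on a finite set, every orbit is periodic.
  period : ∀ σ → ∃[ P ] iter Π (suc P) σ ≡ σ
  period σ with pigeonhole (n<1+n (n * (3 * 2))) (λ i → encode (iter Π (toℕ i) σ))
  ... | i , j , i<j , e with m≤n⇒∃[o]m+o≡n i<j
  ... | o , i+o≡j = o , sym (iter-injective (toℕ i) same)
    where
    same : iter Π (toℕ i) σ ≡ iter Π (toℕ i) (iter Π (suc o) σ)
    same = trans (encode-injective _ _ e)
             (trans (cong (λ m → iter Π m σ) (trans (sym i+o≡j) (sym (+-suc (toℕ i) o))))
                    (sym (iter-+ (toℕ i) (suc o) σ)))

  iter-period-multiple : ∀ c P σ → iter Π (suc P) σ ≡ σ → iter Π (c * suc P) σ ≡ σ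
  iter-period-multiple ℕ.zero P σ e = refl
  iter-period-multiple (suc c) P σ e =
    trans (sym (iter-+ (suc P) (c * suc P) σ))
          (trans (cong (iter Π (suc P)) (iter-period-multiple c P σ e)) e)

  returnsTo : ∀ m {ρ τ} → iter Π m ρ ≡ τ → ∃[ k ] iter Π k τ ≡ ρ
  returnsTo m {ρ} refl with period ρ
  ... | P , eP = m * P ,
    trans (iter-+ (m * P) m ρ)
          (trans (cong (λ k → iter Π k ρ) (trans (+-comm (m * P) m) (sym (*-suc m P))))
                 (iter-period-multiple m P ρ eP))

  onFace-iter⁻ : ∀ k {σ x} → OnFace (iter Π k σ) x → OnFace σ x
  onFace-iter⁻ k {σ} (m , e) = m + k , trans (cong (vtx Π) (sym (iter-+ m k σ))) e

  onFace-iter : ∀ k {σ x} → OnFace σ x → OnFace (iter Π k σ) x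
  onFace-iter k {σ} (m , e) with returnsTo k {σ} refl
  ... | k' , back-to-σ =
    m + k' , trans (cong (vtx Π) (sym (iter-+ m k' (iter Π k σ))))
                   (trans (cong (λ τ → vtx Π (iter Π m τ)) back-to-σ) e)

  rev-iter : ∀ m ρ → iter Π m (rev Π (iter Π m ρ)) ≡ rev Π ρ
  rev-iter ℕ.zero ρ = refl
  rev-iter (suc m) ρ =
    trans (iter-suc m (rev Π (iter Π (suc m) ρ)))
          (trans (cong (iter Π m) (rev-step (iter Π m ρ))) (rev-iter m ρ))

  onFace-rev : ∀ {ρ x} → OnFace ρ x → OnFace (rev Π ρ) x
  onFace-rev {ρ} (m , e) with returnsTo m (rev-iter m ρ)
  ... | k , ek = k , trans (cong (vtx Π) ek) e

  -- both corner vertices lie on the face (the previous one by periodicity)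
  cornerOnFace : ∀ σ {y} → OnCorner σ y → OnFace σ y
  cornerOnFace σ (inj₂ refl) = 1 , refl
  cornerOnFace σ (inj₁ refl) with period σ
  ... | P , eP = P , trans (sym (prev-step (iter Π P σ))) (cong prev eP)

  module Polyhedrality (poly : Polyhedral Π) where

    -- A face passes a vertex only once, so two states of one face at the
    -- same vertex coincide up to reversal.
    sameFaceAtVertex : ∀ {σ τ} → SameFace Π σ τ → vtx Π σ ≡ vtx Π τ → σ ≡ τ ⊎ σ ≡ rev Π τ
    sameFaceAtVertex {σ} (inj₁ (m , e)) ev =
      inj₁ (trans (proj₁ poly σ 0 m (trans ev (cong (vtx Π) (sym e)))) e)
    sameFaceAtVertex {σ} (inj₂ (m , e)) ev =
      inj₂ (trans (proj₁ poly σ 0 m (trans ev (cong (vtx Π) (sym e)))) e)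

    cornerSeparatesFaces : ∀ {σ τ y} → vtx Π σ ≡ vtx Π τ →
      OnCorner σ y → ¬ OnCorner τ y → ¬ SameFace Π σ τ
    cornerSeparatesFaces {τ = τ} ev y∈σ y∉τ same with sameFaceAtVertex same ev
    ... | inj₁ refl = y∉τ y∈σ
    ... | inj₂ refl = y∉τ (OnCorner-rev {τ} y∈σ)

    facesMeetInAtMostTwo : ∀ {σ τ x y z} → ¬ SameFace Π σ τ → x ≢ y → x ≢ z → y ≢ z →
      CommonVertex Π σ τ x → CommonVertex Π σ τ y → CommonVertex Π σ τ z → ⊥
    facesMeetInAtMostTwo {σ} {τ} differ x≢y x≢z y≢z cx cy cz with proj₂ poly σ τ differ
    ... | inj₁ disjoint = disjoint _ cx
    ... | inj₂ (inj₁ (_ , single)) = x≢y (trans (single _ cx) (sym (single _ cy)))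
    ... | inj₂ (inj₂ (_ , _ , _ , _ , onEdge)) =
      threeDistinctInPair x≢y x≢z y≢z (onEdge _ cx) (onEdge _ cy) (onEdge _ cz)

    cornerOrThird : ∀ σ {y z} → Adj G (vtx Π σ) y → Adj G (vtx Π σ) z →
      y ≢ z → z ≢ prev σ → z ≢ next σ → OnCorner σ y
    cornerOrThird σ (_ , refl) (_ , refl) y≢z z≢p z≢n
      with otherTwo (λ e → nextIndex≢idx σ (sym e)) (indicesApart (λ e → z≢p (sym e)))
                    (indicesApart (λ e → z≢n (sym e))) (indicesApart y≢z)
    ... | inj₁ e = inj₁ (cong (nbr (vtx Π σ)) e)
    ... | inj₂ e = inj₂ (cong (nbr (vtx Π σ)) e)

    cornerMeetsPair : ∀ σ {x y z} → vtx Π σ ≡ x → Adj G x y → Adj G x z → y ≢ z →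
      OnCorner σ y ⊎ OnCorner σ z
    cornerMeetsPair σ {z = z} refl x~y x~z y≢z with z ≟ prev σ | z ≟ next σ
    ... | yes z≡p | _ = inj₂ (inj₁ z≡p)
    ... | no _ | yes z≡n = inj₂ (inj₂ z≡n)
    ... | no z≢p | no z≢n = inj₁ (cornerOrThird σ x~y x~z y≢z z≢p z≢n)

    -- Then ω's next vertex lies on φ's corner, the faces differ, and
    -- so they share no vertex besides x and next ω.
    faceThroughThirdEdge : ∀ φ ω {x z} → vtx Π φ ≡ x → vtx Π ω ≡ x →
      prev ω ≢ prev φ → prev ω ≢ next φ → z ≢ x → z ≢ next ω →
      OnFace φ z → OnFace ω z → ⊥
    faceThroughThirdEdge φ (_ , j , t) refl refl ω≢p ω≢n z≢x z≢n z∈φ z∈ω =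
      facesMeetInAtMostTwo differ x≢next (λ e → z≢x (sym e)) (λ e → z≢n (sym e))
        ((0 , refl) , (0 , refl)) ((1 , refl) , cornerOnFace φ next∈φ) (z∈ω , z∈φ)
      where
      ω = (vtx Π φ , j , t)
      x≢next : vtx Π φ ≢ next ω
      x≢next e = loopless (vtx Π φ) (nextIndex Π ω) (sym e)
      next∈φ : OnCorner φ (next ω)
      next∈φ = cornerOrThird φ (nextIndex Π ω , refl) (j , refl)
                 (λ e → prev≢next ω (sym e)) ω≢p ω≢n
      prevω∉φ : ¬ OnCorner φ (prev ω)
      prevω∉φ (inj₁ e) = ω≢p e
      prevω∉φ (inj₂ e) = ω≢n e
      differ : ¬ SameFace Π ω φ
      differ = cornerSeparatesFaces refl (inj₁ refl) prevω∉φ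

    thirdNeighbourOffFace : ∀ σ {x d} → vtx Π σ ≡ x → Adj G x d →
      d ≢ prev σ → d ≢ next σ → ¬ OnFace σ d
    thirdNeighbourOffFace σ refl (k , refl) d≢p d≢n d∈σ =
      faceThroughThirdEdge σ ω refl refl d≢p d≢n (loopless (vtx Π σ) k)
        (prev≢next ω) d∈σ (cornerOnFace ω (inj₁ refl))
      where
      ω = (vtx Π σ , k , false)

    -- Beyond the third neighbour t of vtx σ: a neighbour w of t that is not
    -- adjacent to vtx σ is not on the face of σ either (use the face
    -- around the corner w t (vtx σ)).
    beyondThirdNeighbourOffFace : ∀ σ {x t w} → vtx Π σ ≡ x → Adj G x t →
      t ≢ prev σ → t ≢ next σ → Adj G t w → w ≢ x → ¬ Adj G x w → ¬ OnFace σ w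
    beyondThirdNeighbourOffFace σ {x} σ-at x~t t≢p t≢n t~w w≢x x≁w w∈σ
      with stateThrough t~w (adj-sym x~t) w≢x
    ... | δ , δ-at , δ←w , δ→x =
      faceThroughThirdEdge σ (step Π δ) σ-at δ→x
        (λ e → t≢p (trans (sym (trans (prev-step δ) δ-at)) e))
        (λ e → t≢n (trans (sym (trans (prev-step δ) δ-at)) e))
        w≢x (λ e → x≁w (subst (Adj G x) (sym e) (adjacentNext {step Π δ} δ→x)))
        w∈σ (onFace-iter 1 (cornerOnFace δ (inj₁ (sym δ←w))))

    faceFollowsInducedPath : ∀ {a b c d} → Adj G b c → Adj G c d → a ≢ c → b ≢ d →
      ¬ Adj G b d → ∀ φ → vtx Π φ ≡ a → next φ ≡ b → OnFace φ d →
      Traces Π φ (a ∷ b ∷ c ∷ d ∷ [])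
    faceFollowsInducedPath {a} {b} {c} {d} b~c c~d a≢c b≢d b≁d φ φ-at φ→b d∈φ =
      φ-at , φ→b , turnsToC , reachesD , tt
      where
      φ₁ = step Π φ
      φ₁←a : prev φ₁ ≡ a
      φ₁←a = trans (prev-step φ) φ-at

      -- otherwise the face around the corner d c b meets φ's face in b, d and
      -- a corner vertex of φ₁
      turnsToC : next φ₁ ≡ c
      turnsToC with next φ₁ ≟ c
      ... | yes e = e
      ... | no next≢c with stateThrough c~d (adj-sym b~c) (λ e → b≢d (sym e))
      ... | ω , ω-at , ω←d , ω→b =
        ⊥-elim (faceThroughThirdEdge φ₁ (step Π ω) φ→b ω→b
          (λ e → a≢c (sym (trans (sym ω₁←c) (trans e φ₁←a))))
          (λ e → next≢c (sym (trans (sym ω₁←c) e)))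
          (λ e → b≢d (sym e)) (λ e → b≁d (subst (Adj G b) (sym e) (adjacentNext {step Π ω} ω→b)))
          (onFace-iter 1 d∈φ) (onFace-iter 1 (cornerOnFace ω (inj₁ (sym ω←d)))))
        where
        ω₁←c : prev (step Π ω) ≡ c
        ω₁←c = trans (prev-step ω) ω-at

      -- otherwise d is the third neighbour of c on the face
      reachesD : next (step Π φ₁) ≡ d
      reachesD with next (step Π φ₁) ≟ d
      ... | yes e = e
      ... | no next≢d = ⊥-elim (thirdNeighbourOffFace (step Π φ₁) turnsToC c~d
          (λ e → b≢d (sym (trans e (trans (prev-step φ₁) φ→b)))) (λ e → next≢d (sym e))
          (onFace-iter 2 d∈φ))

    facialSubwalkThroughCorner : ∀ {a b c d} → Adj G b c → Adj G c d → a ≢ c → b ≢ d →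
      ¬ Adj G b d → ∀ σ → vtx Π σ ≡ a → OnCorner σ b → OnFace σ d →
      FacialSubwalk Π (d ∷ c ∷ b ∷ a ∷ [])
    facialSubwalkThroughCorner b~c c~d a≢c b≢d b≁d σ σ-at (inj₂ b≡next) d∈σ =
      σ , inj₂ (faceFollowsInducedPath b~c c~d a≢c b≢d b≁d σ σ-at (sym b≡next) d∈σ)
    facialSubwalkThroughCorner b~c c~d a≢c b≢d b≁d σ σ-at (inj₁ b≡prev) d∈σ =
      rev Π σ , inj₂ (faceFollowsInducedPath b~c c~d a≢c b≢d b≁d (rev Π σ) σ-at
                        (trans (next-rev σ) (sym b≡prev)) (onFace-rev {σ} d∈σ))

    -- Then every face through u and
    -- v uses the edge u t₄: otherwise its corner at v contains t₁ (sharing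
    -- u, t₀, t₁ with α's face) or t₅ (lying beyond the third neighbour t₄).
    faceThroughUVUsesEdge : ∀ {u v t₀ t₁ t₄ t₅} → Adj G u t₄ → Adj G t₄ t₅ →
      Adj G v t₁ → Adj G v t₅ → t₁ ≢ t₅ → t₁ ≢ u → t₁ ≢ t₀ → t₅ ≢ u → ¬ Adj G u t₅ →
      ∀ α → vtx Π α ≡ u → prev α ≡ t₄ → next α ≡ t₀ → OnFace α t₁ →
      ∀ σ → vtx Π σ ≡ u → OnFace σ v → OnCorner σ t₄
    faceThroughUVUsesEdge {t₄ = t₄} u~t₄ t₄~t₅ v~t₁ v~t₅ t₁≢t₅ t₁≢u t₁≢t₀ t₅≢u u≁t₅
      α α-at α←t₄ α→t₀ t₁∈α σ σ-at (m , σₘ-at) with t₄ ≟ prev σ | t₄ ≟ next σ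
    ... | yes t₄≡p | _ = inj₁ t₄≡p
    ... | no _ | yes t₄≡n = inj₂ t₄≡n
    ... | no t₄≢p | no t₄≢n with cornerMeetsPair (iter Π m σ) σₘ-at v~t₁ v~t₅ t₁≢t₅
    ... | inj₁ t₁∈σₘ = ⊥-elim (faceThroughThirdEdge σ α σ-at α-at
            (λ e → t₄≢p (trans (sym α←t₄) e)) (λ e → t₄≢n (trans (sym α←t₄) e))
            t₁≢u (λ e → t₁≢t₀ (trans e α→t₀))
            (onFace-iter⁻ m (cornerOnFace (iter Π m σ) t₁∈σₘ)) t₁∈α)
    ... | inj₂ t₅∈σₘ = ⊥-elim (beyondThirdNeighbourOffFace σ σ-at u~t₄ t₄≢p t₄≢n
            t₄~t₅ t₅≢u u≁t₅ (onFace-iter⁻ m (cornerOnFace (iter Π m σ) t₅∈σₘ)))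

  subwalkEndpoints : ∀ {a b c d} → FacialSubwalk Π (a ∷ b ∷ c ∷ d ∷ []) →
    ∃[ σ ] vtx Π σ ≡ a × OnFace σ d
  subwalkEndpoints (σ , inj₁ (σ-at , _ , _ , σ₃-at , _)) = σ , σ-at , (3 , σ₃-at)
  subwalkEndpoints (σ , inj₂ (σ-at , _ , _ , σ₃-at , _)) =
    iter Π 3 σ , σ₃-at , onFace-iter 3 {σ} (0 , σ-at)

  subwalkCorner : ∀ {a b c d} → FacialSubwalk Π (a ∷ b ∷ c ∷ d ∷ []) →
    ∃[ σ ] vtx Π σ ≡ c × prev σ ≡ d × next σ ≡ b × OnFace σ a
  subwalkCorner (σ , inj₁ (σ-at , σ₁-at , σ₂-at , σ₃-at , _)) =
    rev Π (iter Π 2 σ) , σ₂-at , σ₃-at ,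
    trans (next-rev (iter Π 2 σ)) (trans (prev-step (step Π σ)) σ₁-at) ,
    onFace-rev {iter Π 2 σ} (onFace-iter 2 {σ} (0 , σ-at))
  subwalkCorner (σ , inj₂ (σ-at , σ₁-at , σ₂-at , σ₃-at , _)) =
    step Π σ , σ₁-at , trans (prev-step σ) σ-at , σ₂-at , (2 , σ₃-at)

corollary12 : {n : ℕ} (G : CubicGraph n) (Π : EmbeddingScheme G) →
    Polyhedral Π →
    (u v t₀ t₁ t₂ t₃ t₄ t₅ : Fin n) →
    IsPath G (u ∷ t₀ ∷ t₁ ∷ v ∷ []) →
    IsPath G (u ∷ t₂ ∷ t₃ ∷ v ∷ []) →
    IsPath G (u ∷ t₄ ∷ t₅ ∷ v ∷ []) →
    (t₀ ≢ t₂ × t₀ ≢ t₃ × t₁ ≢ t₂ × t₁ ≢ t₃) →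
    (t₀ ≢ t₄ × t₀ ≢ t₅ × t₁ ≢ t₄ × t₁ ≢ t₅) →
    (t₂ ≢ t₄ × t₂ ≢ t₅ × t₃ ≢ t₄ × t₃ ≢ t₅) →
    ScaffoldEdge Π u v →
    FacialSubwalk Π (t₁ ∷ t₀ ∷ u ∷ t₄ ∷ []) →
    FacialSubwalk Π (v ∷ t₅ ∷ t₄ ∷ u ∷ [])
corollary12 G Π poly u v t₀ t₁ t₂ t₃ t₄ t₅
  ((_ ∷ u≢t₁ ∷ _) ∷ (t₀≢t₁ ∷ _) ∷ _ , u~t₀ , _ , t₁~v , _)
  (_ , u~t₂ , _ , t₃~v , _)
  ((_ ∷ u≢t₅ ∷ _) ∷ (t₄≢t₅ ∷ t₄≢v ∷ _) ∷ _ , u~t₄ , t₄~t₅ , t₅~v , _)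
  (t₀≢t₂ , _ , _ , t₁≢t₃) (t₀≢t₄ , t₀≢t₅ , t₁≢t₄ , t₁≢t₅) (t₂≢t₄ , t₂≢t₅ , t₃≢t₄ , t₃≢t₅)
  (_ , _ , _ , _ , scaffold) αwalk
  = let σ , σ-at , v∈σ = subwalkEndpoints scaffold
        α , α-at , α←t₄ , α→t₀ , t₁∈α = subwalkCorner αwalk
        usesEdge = faceThroughUVUsesEdge u~t₄ t₄~t₅ (adj-sym t₁~v) (adj-sym t₅~v) t₁≢t₅
                     (λ e → u≢t₁ (sym e)) (λ e → t₀≢t₁ (sym e)) (λ e → u≢t₅ (sym e)) u≁t₅
                     α α-at α←t₄ α→t₀ t₁∈α σ σ-at v∈σ
    in facialSubwalkThroughCorner t₄~t₅ t₅~v u≢t₅ t₄≢v t₄≁v σ σ-at usesEdge v∈σ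
  where
  open CubicFacts G
  open FaceTracing Π
  open Polyhedrality poly

  -- u is adjacent exactly to t₀, t₂, t₄, and v exactly to t₁, t₃, t₅
  u≁t₅ : ¬ Adj G u t₅
  u≁t₅ = notAdjacent u~t₀ u~t₂ u~t₄ t₀≢t₂ t₀≢t₄ t₂≢t₄
           (λ e → t₀≢t₅ (sym e)) (λ e → t₂≢t₅ (sym e)) (λ e → t₄≢t₅ (sym e))

  t₄≁v : ¬ Adj G t₄ v
  t₄≁v t₄~v = notAdjacent (adj-sym t₁~v) (adj-sym t₃~v) (adj-sym t₅~v) t₁≢t₃ t₁≢t₅ t₃≢t₅
                (λ e → t₁≢t₄ (sym e)) (λ e → t₃≢t₄ (sym e)) t₄≢t₅ (adj-sym t₄~v)
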